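{- Let $p$ be a prime and let $F=\{n_F\}_{n\geq 0}$ be a sequence of positive integers. Then $F$ is a primary cobweb-admissible sequence for $p$ if and only if $n_F\in\{1,p,p^2,p^3,\dots\}$ for every $n\geq 0$, and, writing $n_F=p^{n_{B(F)}}$ with $n_{B(F)}\in\{0,1,2,\dots\}$, for every $n\geq 1$ and every $1\leq k\leq \lfloor n/2\rfloor$, $$\sum_{s=n-k+1}^{n} s_{B(F)}\ \geq\ \sum_{s=1}^{k} s_{B(F)}.$$
   Context: A sequence $F=\{n_F\}_{n\geq 0}$ of positive integers is called cobweb-admissible if for all integers $0\leq k\leq n$ the $F$-nomial coefficient $$\binom{n}{k}_F=\frac{n_F\cdot (n-1)_F\cdots (n-k+1)_F}{1_F\cdot 2_F\cdots k_F}$$ is a positive integer (the empty product, for $k=0$, equals $1$). For a prime $p$, a primary cobweb-admissible sequence (for $p$) is a cobweb-admissible sequence all of whose values lie in $\{1,p,p^2,p^3,\dots\}$. For such a sequence, $B(F)=\{n_{B(F)}\}_{n\ge 0}$ denotes the sequence of exponents, defined by $n_{B(F)}=m$ iff $n_F=p^m$. -}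

module Defs where

open import Data.Nat using (ℕ; zero; suc; _+_; _*_; _∸_; _^_; _≤_; _/_)
open import Data.Product using (Σ; _×_; ∃)
open import Relation.Binary.PropositionalEquality using (_≡_)

fallingProd : (ℕ → ℕ) → ℕ → ℕ → ℕ
fallingProd F n zero    = 1
fallingProd F n (suc k) = F (n ∸ k) * fallingProd F n k

prodUpTo : (ℕ → ℕ) → ℕ → ℕ
prodUpTo F zero    = 1
prodUpTo F (suc k) = prodUpTo F k * F (suc k)

sumFrom : (ℕ → ℕ) → ℕ → ℕ → ℕ
sumFrom f a zero    = 0
sumFrom f a (suc k) = sumFrom f a k + f (a + suc k)

-- the F-nomial coefficient (n choose k)_F is a positive integer:
-- numerator = c · denominator with c ≥ 1
FNomialPosInt : (ℕ → ℕ) → ℕ → ℕ → Set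
FNomialPosInt F n k = Σ ℕ λ c → (1 ≤ c) × (fallingProd F n k ≡ c * prodUpTo F k)

CobwebAdmissible : (ℕ → ℕ) → Set
CobwebAdmissible F = ∀ n k → k ≤ n → FNomialPosInt F n k

ValuesPowersOf : ℕ → (ℕ → ℕ) → Set
ValuesPowersOf p F = ∀ n → ∃ λ m → F n ≡ p ^ m

PrimaryCobwebAdmissible : ℕ → (ℕ → ℕ) → Set
PrimaryCobwebAdmissible p F = CobwebAdmissible F × ValuesPowersOf p F

-- Writing n_F = p ^ B n, both products in the F-nomial coefficient are powers of p, whose
-- exponents are sums of B over the windows [n-k+1, n] and [1, k]; since p > 1 the
-- coefficient is a positive integer exactly when the top window sum is at least the bottom
-- one. It suffices to ask this for k ≤ n/2: the sums over [1, n] split both as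
-- [1, k] ∪ [k+1, n] and as [1, n-k] ∪ [n-k+1, n], so the inequality for k is equivalent
-- to the one for n - k.
module Submission where

open import Defs
open import Data.Nat using (ℕ; _+_; _*_; _∸_; _^_; _≤_; _≥_; _/_)
open import Data.Nat.Primality using (Prime)
open import Data.Product using (Σ; _×_)
open import Function.Bundles using (_⇔_)
open import Relation.Binary.PropositionalEquality using (_≡_)

open import Data.Nat using (zero; suc; _<_; z≤n; z<s; _%_; _≤?_; >-nonZero)
open import Data.Nat.Base using (nonTrivial⇒n>1)
open import Data.Nat.Properties
open import Data.Nat.DivMod using (m≡m%n+[m/n]*n; m%n<n; m*n/n≡m; /-monoˡ-≤; m/n≤m)
open import Data.Nat.Primality using (prime)
open import Data.Product using (_,_; proj₁; proj₂)
open import Function.Bundles using (mk⇔; Equivalence)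
open import Relation.Binary.PropositionalEquality using (refl; sym; trans; cong; cong₂; subst; module ≡-Reasoning)
open import Relation.Nullary using (Dec; yes; no)

sumFrom-sucˡ : ∀ f a k → sumFrom f a (suc k) ≡ f (suc a) + sumFrom f (suc a) k
sumFrom-sucˡ f a zero = trans (cong f (+-comm a 1)) (sym (+-identityʳ _))
sumFrom-sucˡ f a (suc k) = begin
  sumFrom f a (suc k) + f (a + suc (suc k))           ≡⟨ cong₂ _+_ (sumFrom-sucˡ f a k) (cong f (+-suc a (suc k))) ⟩
  f (suc a) + sumFrom f (suc a) k + f (suc a + suc k) ≡⟨ +-assoc (f (suc a)) _ _ ⟩
  f (suc a) + sumFrom f (suc a) (suc k)               ∎
  where open ≡-Reasoning

sumFrom-+ : ∀ f b a k → sumFrom f b (a + k) ≡ sumFrom f b a + sumFrom f (b + a) k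
sumFrom-+ f b a zero = trans (cong (sumFrom f b) (+-identityʳ a)) (sym (+-identityʳ _))
sumFrom-+ f b a (suc k) = begin
  sumFrom f b (a + suc k)                                 ≡⟨ cong (sumFrom f b) (+-suc a k) ⟩
  sumFrom f b (a + k) + f (b + suc (a + k))               ≡⟨ cong₂ _+_ (sumFrom-+ f b a k) (cong f (sym reassoc)) ⟩
  sumFrom f b a + sumFrom f (b + a) k + f (b + a + suc k) ≡⟨ +-assoc (sumFrom f b a) _ _ ⟩
  sumFrom f b a + sumFrom f (b + a) (suc k)               ∎
  where
  open ≡-Reasoning
  reassoc : b + a + suc k ≡ b + suc (a + k)
  reassoc = trans (+-assoc b a (suc k)) (cong (b +_) (+-suc a k))

window-swap : ∀ f j k → sumFrom f 0 j ≤ sumFrom f k j → sumFrom f 0 k ≤ sumFrom f j k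
window-swap f j k Sj≤ = +-cancelʳ-≤ (sumFrom f 0 j) _ _ (begin
  sumFrom f 0 k + sumFrom f 0 j ≤⟨ +-monoʳ-≤ (sumFrom f 0 k) Sj≤ ⟩
  sumFrom f 0 k + sumFrom f k j ≡⟨ sym (sumFrom-+ f 0 k j) ⟩
  sumFrom f 0 (k + j)           ≡⟨ cong (sumFrom f 0) (+-comm k j) ⟩
  sumFrom f 0 (j + k)           ≡⟨ sumFrom-+ f 0 j k ⟩
  sumFrom f 0 j + sumFrom f j k ≡⟨ +-comm (sumFrom f 0 j) _ ⟩
  sumFrom f j k + sumFrom f 0 j ∎)
  where open ≤-Reasoning

sumFrom-top-suc : ∀ f n k → suc k ≤ n →
  sumFrom f (n ∸ suc k) (suc k) ≡ f (n ∸ k) + sumFrom f (n ∸ k) k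
sumFrom-top-suc f n k k<n = begin
  sumFrom f (n ∸ suc k) (suc k)                       ≡⟨ sumFrom-sucˡ f (n ∸ suc k) k ⟩
  f (suc (n ∸ suc k)) + sumFrom f (suc (n ∸ suc k)) k ≡⟨ cong (λ m → f m + sumFrom f m k) (sym (+-∸-assoc 1 k<n)) ⟩
  f (n ∸ k) + sumFrom f (n ∸ k) k                     ∎
  where open ≡-Reasoning

module _ {p : ℕ} {F B : ℕ → ℕ} (F≡p^B : ∀ n → F n ≡ p ^ B n) where

  prodUpTo-^ : ∀ k → prodUpTo F k ≡ p ^ sumFrom B 0 k
  prodUpTo-^ zero = refl
  prodUpTo-^ (suc k) = trans (cong₂ _*_ (prodUpTo-^ k) (F≡p^B (suc k)))
                             (sym (^-distribˡ-+-* p (sumFrom B 0 k) (B (suc k))))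

  fallingProd-^ : ∀ n k → k ≤ n → fallingProd F n k ≡ p ^ sumFrom B (n ∸ k) k
  fallingProd-^ n zero _ = refl
  fallingProd-^ n (suc k) k<n = begin
    F (n ∸ k) * fallingProd F n k               ≡⟨ cong₂ _*_ (F≡p^B (n ∸ k)) (fallingProd-^ n k (<⇒≤ k<n)) ⟩
    p ^ B (n ∸ k) * p ^ sumFrom B (n ∸ k) k     ≡⟨ sym (^-distribˡ-+-* p (B (n ∸ k)) _) ⟩
    p ^ (B (n ∸ k) + sumFrom B (n ∸ k) k)       ≡⟨ cong (p ^_) (sym (sumFrom-top-suc B n k k<n)) ⟩
    p ^ sumFrom B (n ∸ suc k) (suc k)           ∎
    where open ≡-Reasoning

^-positiveMultiple⇔≤ : ∀ {p} → 1 < p → ∀ s w →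
  (Σ ℕ λ c → 1 ≤ c × p ^ w ≡ c * p ^ s) ⇔ s ≤ w
^-positiveMultiple⇔≤ {p} 1<p s w = mk⇔ to from
  where
  instance _ = >-nonZero (<-trans z<s 1<p)

  to : (Σ ℕ λ c → 1 ≤ c × p ^ w ≡ c * p ^ s) → s ≤ w
  to (c , 1≤c , p^w≡c*p^s) = ≮⇒≥ λ w<s → <⇒≱ (^-monoʳ-< p 1<p w<s) (begin
    p ^ s     ≤⟨ m≤n*m (p ^ s) c ⟩
    c * p ^ s ≡⟨ sym p^w≡c*p^s ⟩
    p ^ w     ∎)
    where
    open ≤-Reasoning
    instance _ = >-nonZero 1≤c

  from : s ≤ w → Σ ℕ λ c → 1 ≤ c × p ^ w ≡ c * p ^ s
  from s≤w = p ^ (w ∸ s) , m^n>0 p (w ∸ s) , (begin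
    p ^ w               ≡⟨ cong (p ^_) (sym (m∸n+n≡m s≤w)) ⟩
    p ^ (w ∸ s + s)     ≡⟨ ^-distribˡ-+-* p (w ∸ s) s ⟩
    p ^ (w ∸ s) * p ^ s ∎)
    where open ≡-Reasoning

fNomialPosInt⇔windows : ∀ {p F B} → 1 < p → (∀ n → F n ≡ p ^ B n) → ∀ n k → k ≤ n →
  FNomialPosInt F n k ⇔ sumFrom B 0 k ≤ sumFrom B (n ∸ k) k
fNomialPosInt⇔windows {p} {F} {B} 1<p F≡p^B n k k≤n
  rewrite fallingProd-^ F≡p^B n k k≤n | prodUpTo-^ F≡p^B k =
  ^-positiveMultiple⇔≤ 1<p (sumFrom B 0 k) (sumFrom B (n ∸ k) k)

m*2≡m+m : ∀ m → m * 2 ≡ m + m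
m*2≡m+m m = trans (*-comm m 2) (cong (m +_) (+-identityʳ m))

n/2<k⇒n∸k≤n/2 : ∀ {n k} → k ≤ n → n / 2 < k → n ∸ k ≤ n / 2
n/2<k⇒n∸k≤n/2 {n} {k} k≤n n/2<k = begin
  n ∸ k           ≡⟨ sym (m*n/n≡m (n ∸ k) 2) ⟩
  (n ∸ k) * 2 / 2 ≤⟨ /-monoˡ-≤ 2 [n∸k]*2≤n ⟩
  n / 2           ∎
  where
  open ≤-Reasoning
  n<k*2 : n < k * 2
  n<k*2 = begin-strict
    n                   ≡⟨ m≡m%n+[m/n]*n n 2 ⟩
    n % 2 + n / 2 * 2   <⟨ +-monoˡ-< (n / 2 * 2) (m%n<n n 2) ⟩
    2 + n / 2 * 2       ≤⟨ *-monoˡ-≤ 2 n/2<k ⟩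
    k * 2               ∎
  n∸k+k≡n : n ∸ k + k ≡ n
  n∸k+k≡n = m∸n+n≡m k≤n
  n∸k<k : n ∸ k < k
  n∸k<k = +-cancelʳ-< k (n ∸ k) k (begin-strict
    n ∸ k + k ≡⟨ n∸k+k≡n ⟩
    n         <⟨ n<k*2 ⟩
    k * 2     ≡⟨ m*2≡m+m k ⟩
    k + k     ∎)
  [n∸k]*2≤n : (n ∸ k) * 2 ≤ n
  [n∸k]*2≤n = begin
    (n ∸ k) * 2     ≡⟨ m*2≡m+m (n ∸ k) ⟩
    n ∸ k + (n ∸ k) ≤⟨ +-monoʳ-≤ (n ∸ k) (<⇒≤ n∸k<k) ⟩
    n ∸ k + k       ≡⟨ n∸k+k≡n ⟩
    n               ∎

HalfWindowCondition : (ℕ → ℕ) → Set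
HalfWindowCondition B =
  ∀ n k → 1 ≤ n → 1 ≤ k → k ≤ n / 2 → sumFrom B (n ∸ k) k ≥ sumFrom B 0 k

halfWindows⇒windows : ∀ B → HalfWindowCondition B →
  ∀ n k → k ≤ n → sumFrom B 0 k ≤ sumFrom B (n ∸ k) k
halfWindows⇒windows B half n k k≤n = byCases (k ≤? n / 2)
  where
  lowerHalf : ∀ j → j ≤ n / 2 → sumFrom B 0 j ≤ sumFrom B (n ∸ j) j
  lowerHalf zero    _     = z≤n
  lowerHalf (suc j) j<n/2 = half n (suc j) (≤-trans z<s (≤-trans j<n/2 (m/n≤m n 2))) z<s j<n/2

  byCases : Dec (k ≤ n / 2) → sumFrom B 0 k ≤ sumFrom B (n ∸ k) k
  byCases (yes k≤n/2) = lowerHalf k k≤n/2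
  byCases (no  k≰n/2) = window-swap B (n ∸ k) k
    (subst (λ m → sumFrom B 0 (n ∸ k) ≤ sumFrom B m (n ∸ k)) (m∸[m∸n]≡n k≤n)
      (lowerHalf (n ∸ k) (n/2<k⇒n∸k≤n/2 k≤n (≰⇒> k≰n/2))))

lemma1 : (p : ℕ) → Prime p → (F : ℕ → ℕ) → (∀ n → 1 ≤ F n) →
    PrimaryCobwebAdmissible p F ⇔
      (ValuesPowersOf p F ×
        Σ (ℕ → ℕ) λ B → (∀ n → F n ≡ p ^ B n) ×
          (∀ n k → 1 ≤ n → 1 ≤ k → k ≤ n / 2 →
            sumFrom B (n ∸ k) k ≥ sumFrom B 0 k))
lemma1 p (prime {{p-nonTrivial}} _) F _ = mk⇔ admissible⇒halfWindows halfWindows⇒admissible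
  where
  1<p : 1 < p
  1<p = nonTrivial⇒n>1 p

  Exponents : Set
  Exponents = Σ (ℕ → ℕ) λ B → (∀ n → F n ≡ p ^ B n) × HalfWindowCondition B

  admissible⇒halfWindows : PrimaryCobwebAdmissible p F → ValuesPowersOf p F × Exponents
  admissible⇒halfWindows (admissible , powers) =
    powers , B , F≡p^B , λ n k _ _ k≤n/2 →
      let k≤n = ≤-trans k≤n/2 (m/n≤m n 2)
      in Equivalence.to (fNomialPosInt⇔windows 1<p F≡p^B n k k≤n) (admissible n k k≤n)
    where
    B : ℕ → ℕ
    B n = proj₁ (powers n)
    F≡p^B : ∀ n → F n ≡ p ^ B n
    F≡p^B n = proj₂ (powers n)

  halfWindows⇒admissible : ValuesPowersOf p F × Exponents → PrimaryCobwebAdmissible p F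
  halfWindows⇒admissible (powers , B , F≡p^B , half) =
    (λ n k k≤n → Equivalence.from (fNomialPosInt⇔windows 1<p F≡p^B n k k≤n)
                   (halfWindows⇒windows B half n k k≤n))
    , powers
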